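{- Let $f(n)=\sum_{j=0}^{n}(-1)^{j}S(n,j)$. Let $k$ be a positive integer and define $a_{r,k}(X)\in\mathbb{Z}[X]$ by $$(X-Y)(X+1-Y)\cdots(X+k-1-Y)=\sum_{r=0}^{k}a_{r,k}(X)Y^r.$$ Then for all integers $n\ge 0$, $$f(n)\equiv\sum_{r=1}^{k}a_{r,k}(0)\,f(n+r)\pmod k.$$
   Context: $S(n,k)$ denotes the Stirling number of the second kind (number of partitions of an $n$-element set into $k$ nonempty blocks, $S(0,0)=1$). -}

module Defs where

open import Data.Nat as ℕ using (ℕ; zero; suc)
open import Data.Integer as ℤ using (ℤ; +_; -_; _+_; _*_; _-_)
open import Data.List using (List; []; _∷_)

S : ℕ → ℕ → ℕ
S zero    zero    = 1
S zero    (suc k) = 0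
S (suc n) zero    = 0
S (suc n) (suc k) = suc k ℕ.* S n (suc k) ℕ.+ S n k

sign : ℕ → ℤ
sign zero    = + 1
sign (suc j) = - sign j

sumFrom : ℕ → ℕ → (ℕ → ℤ) → ℤ
sumFrom a zero    g = + 0
sumFrom a (suc m) g = g a + sumFrom (suc a) m g

f : ℕ → ℤ
f n = sumFrom 0 (suc n) (λ j → sign j * + S n j)

-- Polynomials in Y with integer coefficients: coefficient lists, lowest degree first.
Poly : Set
Poly = List ℤ

coeff : Poly → ℕ → ℤ
coeff []       r       = + 0
coeff (c ∷ p)  zero    = c
coeff (c ∷ p)  (suc r) = coeff p r

shiftY : Poly → Poly
shiftY p = + 0 ∷ p

scale : ℤ → Poly → Poly
scale c []      = []
scale c (a ∷ p) = c * a ∷ scale c p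

addP : Poly → Poly → Poly
addP []      q       = q
addP (a ∷ p) []      = a ∷ p
addP (a ∷ p) (b ∷ q) = (a + b) ∷ addP p q

mulLin : ℤ → Poly → Poly
mulLin c p = addP (scale c p) (scale (- + 1) (shiftY p))

prodFrom : ℤ → ℕ → ℕ → Poly
prodFrom x m zero    = + 1 ∷ []
prodFrom x m (suc k) = mulLin (x + + m) (prodFrom x (suc m) k)

-- a_{r,k}(x): the coefficient of Y^r in (x - Y)(x+1-Y)...(x+k-1-Y),
-- i.e. the polynomial a_{r,k}(X) ∈ ℤ[X] evaluated at X = x.
a : ℕ → ℕ → ℤ → ℤ
a r k x = coeff (prodFrom x 0 k) r

-- Write E for the shift u ↦ u ∘ suc on integer sequences. The coefficients a_{r,k}(0)
-- are those of P(Y) = (0 − Y)(1 − Y)⋯(k − 1 − Y), so Σ_r a_{r,k}(0) f(n + r) is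
-- ((0 − E)(1 − E)⋯(k − 1 − E) f)(n), and the sum may start at r = 1 because P(0) = 0.
-- Applying the factors one at a time turns the Stirling numbers S(n, j) inside f into the
-- r-Stirling numbers S_k(n + k, j + k), whose recurrence differs from that of S(n, j)
-- only by multiples of k. Hence the product applied to f agrees with f modulo k.
module Submission where

open import Defs
open import Data.Nat using (ℕ; suc; NonZero)
open import Data.Integer using (+_; _-_; _*_)
open import Data.Integer.Divisibility using (_∣_)

open import Data.Nat as ℕ using (zero; _<_; _⊔_; s≤s)
import Data.Nat.Properties as ℕ
import Data.Nat.Tactic.RingSolver as ℕ-Solver
open import Data.Integer as ℤ using (ℤ; _+_; -_)
import Data.Integer.Properties as ℤ
open import Data.Integer.Tactic.RingSolver using (solve-∀)
open import Data.Integer.Divisibility.Signed as Signed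
  using (divides; ∣m∣n⇒∣m+n; ∣n⇒∣m*n; ∣⇒∣ᵤ)
open import Data.List using ([]; _∷_; length)
open import Data.Product using (∃-syntax; _,_)
open import Function using (_∘_)
open import Relation.Binary.PropositionalEquality
open ≡-Reasoning

sumFrom-cong : ∀ a m {u v : ℕ → ℤ} → (∀ j → u j ≡ v j) →
  sumFrom a m u ≡ sumFrom a m v
sumFrom-cong a zero    u≡v = refl
sumFrom-cong a (suc m) u≡v = cong₂ _+_ (u≡v a) (sumFrom-cong (suc a) m u≡v)

sumFrom-suc : ∀ a m (u : ℕ → ℤ) → sumFrom (suc a) m u ≡ sumFrom a m (u ∘ suc)
sumFrom-suc a zero    u = refl
sumFrom-suc a (suc m) u = cong (_+_ (u (suc a))) (sumFrom-suc (suc a) m u)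

sumFrom-snoc : ∀ a m (u : ℕ → ℤ) → sumFrom a (suc m) u ≡ sumFrom a m u + u (a ℕ.+ m)
sumFrom-snoc a zero u = begin
  u a + + 0          ≡⟨ ℤ.+-comm (u a) (+ 0) ⟩
  + 0 + u a          ≡⟨ cong (λ i → + 0 + u i) (ℕ.+-identityʳ a) ⟨
  + 0 + u (a ℕ.+ 0)  ∎
sumFrom-snoc a (suc m) u = begin
  u a + sumFrom (suc a) (suc m) u
    ≡⟨ cong (_+_ (u a)) (sumFrom-snoc (suc a) m u) ⟩
  u a + (sumFrom (suc a) m u + u (suc a ℕ.+ m))
    ≡⟨ ℤ.+-assoc (u a) _ _ ⟨
  sumFrom a (suc m) u + u (suc a ℕ.+ m)
    ≡⟨ cong (λ i → sumFrom a (suc m) u + u i) (ℕ.+-suc a m) ⟨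
  sumFrom a (suc m) u + u (a ℕ.+ suc m)
    ∎

sumFrom-linear : ∀ a m (x y : ℤ) (u v : ℕ → ℤ) →
  sumFrom a m (λ j → x * u j + y * v j) ≡ x * sumFrom a m u + y * sumFrom a m v
sumFrom-linear a zero    x y u v = sym (cong₂ _+_ (ℤ.*-zeroʳ x) (ℤ.*-zeroʳ y))
sumFrom-linear a (suc m) x y u v = begin
  (x * u a + y * v a) + sumFrom (suc a) m (λ j → x * u j + y * v j)
    ≡⟨ cong (_+_ (x * u a + y * v a)) (sumFrom-linear (suc a) m x y u v) ⟩
  (x * u a + y * v a) + (x * sumFrom (suc a) m u + y * sumFrom (suc a) m v)
    ≡⟨ regroup x y (u a) (v a) _ _ ⟩
  x * sumFrom a (suc m) u + y * sumFrom a (suc m) v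
    ∎
  where
  regroup : ∀ x y p q r s → (x * p + y * q) + (x * r + y * s) ≡ x * (p + r) + y * (q + s)
  regroup = solve-∀

sumFrom-∣ : ∀ {d} a m (u v : ℕ → ℤ) → (∀ j → d Signed.∣ u j - v j) →
  d Signed.∣ sumFrom a m u - sumFrom a m v
sumFrom-∣ a zero    u v d∣u-v = divides (+ 0) refl
sumFrom-∣ a (suc m) u v d∣u-v =
  subst (_ Signed.∣_) (sym (regroup (u a) _ (v a) _))
    (∣m∣n⇒∣m+n (d∣u-v a) (sumFrom-∣ (suc a) m u v d∣u-v))
  where
  regroup : ∀ p q r s → (p + q) - (r + s) ≡ (p - r) + (q - s)
  regroup = solve-∀

-- rStirling c n j is the r-Stirling number S_c(n + c, j + c), which counts partitions of
-- an (n + c)-set into j + c blocks keeping c fixed elements in distinct blocks.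
rStirling : ℕ → ℕ → ℕ → ℕ
rStirling c zero    zero    = 1
rStirling c zero    (suc j) = 0
rStirling c (suc n) zero    = c ℕ.* rStirling c n zero
rStirling c (suc n) (suc j) = (suc j ℕ.+ c) ℕ.* rStirling c n (suc j) ℕ.+ rStirling c n j

rStirling≡S+c* : ∀ c n j → ∃[ d ] rStirling c n j ≡ S n j ℕ.+ c ℕ.* d
rStirling≡S+c* c zero    zero    = 0 , cong suc (sym (ℕ.*-zeroʳ c))
rStirling≡S+c* c zero    (suc j) = 0 , sym (ℕ.*-zeroʳ c)
rStirling≡S+c* c (suc n) zero    = rStirling c n zero , refl
rStirling≡S+c* c (suc n) (suc j)
  with d₁ , eq₁ ← rStirling≡S+c* c n (suc j) | d₂ , eq₂ ← rStirling≡S+c* c n j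
  rewrite eq₁ | eq₂ =
  S n (suc j) ℕ.+ (suc j ℕ.+ c) ℕ.* d₁ ℕ.+ d₂ ,
  regroup (suc j) c (S n (suc j)) (S n j) d₁ d₂
  where
  regroup : ∀ J c A B d₁ d₂ →
    (J ℕ.+ c) ℕ.* (A ℕ.+ c ℕ.* d₁) ℕ.+ (B ℕ.+ c ℕ.* d₂)
      ≡ (J ℕ.* A ℕ.+ B) ℕ.+ c ℕ.* (A ℕ.+ (J ℕ.+ c) ℕ.* d₁ ℕ.+ d₂)
  regroup = ℕ-Solver.solve-∀

rStirling-zero : ∀ n j → rStirling 0 n j ≡ S n j
rStirling-zero n j with d , eq ← rStirling≡S+c* 0 n j = trans eq (ℕ.+-identityʳ (S n j))

c∣S-rStirling : ∀ c n j → + c Signed.∣ + S n j - + rStirling c n j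
c∣S-rStirling c n j with d , eq ← rStirling≡S+c* c n j = divides (- + d) (begin
  + S n j - + rStirling c n j        ≡⟨ cong (λ r → + S n j - + r) eq ⟩
  + S n j - + (S n j ℕ.+ c ℕ.* d)    ≡⟨ cong (_-_ (+ S n j)) (ℤ.pos-+ (S n j) (c ℕ.* d)) ⟩
  + S n j - (+ S n j + + (c ℕ.* d))  ≡⟨ cong (λ r → + S n j - (+ S n j + r)) (ℤ.pos-* c d) ⟩
  + S n j - (+ S n j + + c * + d)    ≡⟨ cancel (+ S n j) (+ c) (+ d) ⟩
  - + d * + c                        ∎)
  where
  cancel : ∀ s c d → s - (s + c * d) ≡ - d * c
  cancel = solve-∀

rStirling-vanish : ∀ c {n j} → n < j → rStirling c n j ≡ 0
rStirling-vanish c {zero}  {suc j} _         = refl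
rStirling-vanish c {suc n} {suc j} (s≤s n<j)
  rewrite rStirling-vanish c (ℕ.m<n⇒m<1+n n<j) | rStirling-vanish c n<j =
  trans (ℕ.+-identityʳ _) (ℕ.*-zeroʳ (suc j ℕ.+ c))

-- A further element either lies in a block without distinguished elements or joins the
-- block of one of the c distinguished ones.
rStirling-suc-suc : ∀ c n i →
  rStirling c (suc n) (suc i) ≡ rStirling (suc c) n i ℕ.+ c ℕ.* rStirling c n (suc i)
rStirling-suc-suc c zero zero = ℕ.+-comm (c ℕ.* 0) 1
rStirling-suc-suc c zero (suc i) rewrite ℕ.*-zeroʳ c | ℕ.*-zeroʳ (i ℕ.+ c) = refl
rStirling-suc-suc c (suc n) zero = begin
  (1 ℕ.+ c) ℕ.* rStirling c (suc n) 1 ℕ.+ c ℕ.* Q 0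
    ≡⟨ cong (λ r → (1 ℕ.+ c) ℕ.* r ℕ.+ c ℕ.* Q 0) (rStirling-suc-suc c n zero) ⟩
  (1 ℕ.+ c) ℕ.* (R 0 ℕ.+ c ℕ.* Q 1) ℕ.+ c ℕ.* Q 0
    ≡⟨ regroup c (R 0) (Q 1) (Q 0) ⟩
  (1 ℕ.+ c) ℕ.* R 0 ℕ.+ c ℕ.* ((1 ℕ.+ c) ℕ.* Q 1 ℕ.+ Q 0)
    ∎
  where
  Q = rStirling c n
  R = rStirling (suc c) n
  regroup : ∀ c A B C →
    (1 ℕ.+ c) ℕ.* (A ℕ.+ c ℕ.* B) ℕ.+ c ℕ.* C
      ≡ (1 ℕ.+ c) ℕ.* A ℕ.+ c ℕ.* ((1 ℕ.+ c) ℕ.* B ℕ.+ C)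
  regroup = ℕ-Solver.solve-∀
rStirling-suc-suc c (suc n) (suc i) = begin
  (2+i+c) ℕ.* rStirling c (suc n) (2 ℕ.+ i) ℕ.+ rStirling c (suc n) (suc i)
    ≡⟨ cong₂ (λ r s → (2+i+c) ℕ.* r ℕ.+ s)
             (rStirling-suc-suc c n (suc i)) (rStirling-suc-suc c n i) ⟩
  (2+i+c) ℕ.* (R (suc i) ℕ.+ c ℕ.* Q (2 ℕ.+ i)) ℕ.+ (R i ℕ.+ c ℕ.* Q (suc i))
    ≡⟨ regroup i c (R (suc i)) (Q (2 ℕ.+ i)) (R i) (Q (suc i)) ⟩
  (suc i ℕ.+ suc c) ℕ.* R (suc i) ℕ.+ R i
    ℕ.+ c ℕ.* ((2+i+c) ℕ.* Q (2 ℕ.+ i) ℕ.+ Q (suc i))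
    ∎
  where
  Q = rStirling c n
  R = rStirling (suc c) n
  2+i+c = 2 ℕ.+ i ℕ.+ c
  regroup : ∀ i c A B C E →
    (2 ℕ.+ i ℕ.+ c) ℕ.* (A ℕ.+ c ℕ.* B) ℕ.+ (C ℕ.+ c ℕ.* E)
      ≡ (1 ℕ.+ i ℕ.+ (1 ℕ.+ c)) ℕ.* A ℕ.+ C
          ℕ.+ c ℕ.* ((2 ℕ.+ i ℕ.+ c) ℕ.* B ℕ.+ E)
  regroup = ℕ-Solver.solve-∀

minusShift : ℤ → (ℕ → ℤ) → ℕ → ℤ
minusShift c u n = c * u n - u (suc n)

minusShift-cong : ∀ c {u v : ℕ → ℤ} → (∀ n → u n ≡ v n) →
  ∀ n → minusShift c u n ≡ minusShift c v n
minusShift-cong c u≡v n = cong₂ (λ x y → c * x - y) (u≡v n) (u≡v (suc n))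

minusShift-comm : ∀ b c u n → minusShift b (minusShift c u) n ≡ minusShift c (minusShift b u) n
minusShift-comm b c u n = swap b c (u n) (u (suc n)) (u (suc (suc n)))
  where
  swap : ∀ b c x y z → b * (c * x - y) - (c * y - z) ≡ c * (b * x - y) - (b * y - z)
  swap = solve-∀

altRS< : ℕ → ℕ → ℕ → ℤ
altRS< c n m = sumFrom 0 m (λ j → sign j * + rStirling c n j)

altRS : ℕ → ℕ → ℤ
altRS c n = altRS< c n (suc n)

altRS-zero : ∀ n → altRS 0 n ≡ f n
altRS-zero n = sumFrom-cong 0 (suc n) (λ j → cong (λ s → sign j * + s) (rStirling-zero n j))

altRS<-overshoot : ∀ c n → altRS< c n (2 ℕ.+ n) ≡ altRS c n
altRS<-overshoot c n = begin
  altRS< c n (2 ℕ.+ n)                    ≡⟨ sumFrom-snoc 0 (suc n) (λ j → sign j * + Q j) ⟩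
  altRS c n + sign (suc n) * + Q (suc n)  ≡⟨ cong (λ q → altRS c n + sign (suc n) * + q)
                                                  (rStirling-vanish c (ℕ.n<1+n n)) ⟩
  altRS c n + sign (suc n) * + 0          ≡⟨ cong (_+_ (altRS c n)) (ℤ.*-zeroʳ (sign (suc n))) ⟩
  altRS c n + + 0                         ≡⟨ ℤ.+-identityʳ (altRS c n) ⟩
  altRS c n                               ∎
  where
  Q = rStirling c n

altRS<-suc : ∀ c n m → altRS< c (suc n) (suc m) ≡ + c * altRS< c n (suc m) - altRS< (suc c) n m
altRS<-suc c n m = begin
  + 1 * + (c ℕ.* Q 0) + sumFrom 1 m (λ j → sign j * + rStirling c (suc n) j)
    ≡⟨ cong₂ (λ x s → + 1 * x + s) (ℤ.pos-* c (Q 0)) (sumFrom-suc 0 m _) ⟩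
  + 1 * (+ c * + Q 0) + sumFrom 0 m (λ i → sign (suc i) * + rStirling c (suc n) (suc i))
    ≡⟨ cong (_+_ (+ 1 * (+ c * + Q 0))) (sumFrom-cong 0 m term) ⟩
  + 1 * (+ c * + Q 0) + sumFrom 0 m (λ i → - + 1 * (sign i * + R i) + + c * tail i)
    ≡⟨ cong (_+_ (+ 1 * (+ c * + Q 0))) (sumFrom-linear 0 m (- + 1) (+ c) _ tail) ⟩
  + 1 * (+ c * + Q 0) + (- + 1 * altRS< (suc c) n m + + c * sumFrom 0 m tail)
    ≡⟨ regroup (+ c) (+ Q 0) (altRS< (suc c) n m) (sumFrom 0 m tail) ⟩
  + c * (+ 1 * + Q 0 + sumFrom 0 m tail) - altRS< (suc c) n m
    ≡⟨ cong (λ s → + c * (+ 1 * + Q 0 + s) - altRS< (suc c) n m) (sumFrom-suc 0 m _) ⟨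
  + c * altRS< c n (suc m) - altRS< (suc c) n m
    ∎
  where
  Q = rStirling c n
  R = rStirling (suc c) n

  tail : ℕ → ℤ
  tail i = sign (suc i) * + Q (suc i)

  distrib : ∀ s A c B → (- s) * (A + c * B) ≡ - + 1 * (s * A) + c * ((- s) * B)
  distrib = solve-∀

  term : ∀ i →
    sign (suc i) * + rStirling c (suc n) (suc i) ≡ - + 1 * (sign i * + R i) + + c * tail i
  term i = begin
    sign (suc i) * + rStirling c (suc n) (suc i)
      ≡⟨ cong (λ r → sign (suc i) * + r) (rStirling-suc-suc c n i) ⟩
    sign (suc i) * + (R i ℕ.+ c ℕ.* Q (suc i))
      ≡⟨ cong (sign (suc i) *_) (ℤ.pos-+ (R i) (c ℕ.* Q (suc i))) ⟩
    sign (suc i) * (+ R i + + (c ℕ.* Q (suc i)))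
      ≡⟨ cong (λ x → sign (suc i) * (+ R i + x)) (ℤ.pos-* c (Q (suc i))) ⟩
    - sign i * (+ R i + + c * + Q (suc i))
      ≡⟨ distrib (sign i) (+ R i) (+ c) (+ Q (suc i)) ⟩
    - + 1 * (sign i * + R i) + + c * tail i
      ∎

  regroup : ∀ c A B C → + 1 * (c * A) + (- + 1 * B + c * C) ≡ c * (+ 1 * A + C) - B
  regroup = solve-∀

altRS-suc : ∀ c n → altRS (suc c) n ≡ minusShift (+ c) (altRS c) n
altRS-suc c n = begin
  altRS (suc c) n
    ≡⟨ solve-for-y (+ c * altRS c n) (altRS (suc c) n) ⟩
  + c * altRS c n - (+ c * altRS c n - altRS (suc c) n)
    ≡⟨ cong (λ s → + c * altRS c n - (+ c * s - altRS (suc c) n)) (altRS<-overshoot c n) ⟨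
  + c * altRS c n - (+ c * altRS< c n (2 ℕ.+ n) - altRS (suc c) n)
    ≡⟨ cong (_-_ (+ c * altRS c n)) (altRS<-suc c n (suc n)) ⟨
  minusShift (+ c) (altRS c) n
    ∎
  where
  solve-for-y : ∀ x y → y ≡ x - (x - y)
  solve-for-y = solve-∀

c∣f-altRS : ∀ c n → + c Signed.∣ f n - altRS c n
c∣f-altRS c n =
  sumFrom-∣ 0 (suc n) (λ j → sign j * + S n j) (λ j → sign j * + rStirling c n j) λ j →
    subst (_ Signed.∣_) (sym (*-distribˡ-- (sign j) (+ S n j) (+ rStirling c n j)))
      (∣n⇒∣m*n (sign j) (c∣S-rStirling c n j))
  where
  *-distribˡ-- : ∀ s x y → s * x - s * y ≡ s * (x - y)
  *-distribˡ-- = solve-∀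

-- applyPoly u p n is (p(E) u)(n).
applyPoly : (ℕ → ℤ) → Poly → ℕ → ℤ
applyPoly u []      n = + 0
applyPoly u (c ∷ p) n = c * u n + applyPoly u p (suc n)

applyPoly-addP : ∀ u p q n → applyPoly u (addP p q) n ≡ applyPoly u p n + applyPoly u q n
applyPoly-addP u []      q       n = sym (ℤ.+-identityˡ _)
applyPoly-addP u (x ∷ p) []      n = sym (ℤ.+-identityʳ _)
applyPoly-addP u (x ∷ p) (y ∷ q) n =
  trans (cong (_+_ ((x + y) * u n)) (applyPoly-addP u p q (suc n))) (regroup x y (u n) _ _)
  where
  regroup : ∀ x y U A B → (x + y) * U + (A + B) ≡ (x * U + A) + (y * U + B)
  regroup = solve-∀

applyPoly-scale : ∀ u c p n → applyPoly u (scale c p) n ≡ c * applyPoly u p n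
applyPoly-scale u c []      n = sym (ℤ.*-zeroʳ c)
applyPoly-scale u c (x ∷ p) n =
  trans (cong (_+_ (c * x * u n)) (applyPoly-scale u c p (suc n))) (regroup c x (u n) _)
  where
  regroup : ∀ c x U A → c * x * U + c * A ≡ c * (x * U + A)
  regroup = solve-∀

applyPoly-mulLin : ∀ u c p n → applyPoly u (mulLin c p) n ≡ minusShift c (applyPoly u p) n
applyPoly-mulLin u c p n = begin
  applyPoly u (addP (scale c p) (scale (- + 1) (shiftY p))) n
    ≡⟨ applyPoly-addP u (scale c p) _ n ⟩
  applyPoly u (scale c p) n + applyPoly u (scale (- + 1) (shiftY p)) n
    ≡⟨ cong₂ _+_ (applyPoly-scale u c p n) (applyPoly-scale u (- + 1) (shiftY p) n) ⟩
  c * applyPoly u p n + - + 1 * (+ 0 * u n + applyPoly u p (suc n))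
    ≡⟨ simplify c _ (u n) _ ⟩
  minusShift c (applyPoly u p) n
    ∎
  where
  simplify : ∀ c A U B → c * A + - + 1 * (+ 0 * U + B) ≡ c * A - B
  simplify = solve-∀

-- The factors of prodFrom commute, so the last one can be peeled off as well as the first.
applyPoly-prodFrom-suc : ∀ u x m k n →
  applyPoly u (prodFrom x m (suc k)) n
    ≡ minusShift (x + + (m ℕ.+ k)) (applyPoly u (prodFrom x m k)) n
applyPoly-prodFrom-suc u x m zero n rewrite ℕ.+-identityʳ m =
  applyPoly-mulLin u (x + + m) (+ 1 ∷ []) n
applyPoly-prodFrom-suc u x m (suc k) n rewrite ℕ.+-suc m k = begin
  applyPoly u (mulLin (x + + m) (prodFrom x (suc m) (suc k))) n
    ≡⟨ applyPoly-mulLin u (x + + m) (prodFrom x (suc m) (suc k)) n ⟩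
  minusShift (x + + m) (applyPoly u (prodFrom x (suc m) (suc k))) n
    ≡⟨ minusShift-cong (x + + m) (applyPoly-prodFrom-suc u x (suc m) k) n ⟩
  minusShift (x + + m) (minusShift last (applyPoly u (prodFrom x (suc m) k))) n
    ≡⟨ minusShift-comm (x + + m) last (applyPoly u (prodFrom x (suc m) k)) n ⟩
  minusShift last (minusShift (x + + m) (applyPoly u (prodFrom x (suc m) k))) n
    ≡⟨ minusShift-cong last (applyPoly-mulLin u (x + + m) (prodFrom x (suc m) k)) n ⟨
  minusShift last (applyPoly u (prodFrom x m (suc k))) n
    ∎
  where
  last = x + + (suc m ℕ.+ k)

applyPoly-prodFrom≡altRS : ∀ k n → applyPoly f (prodFrom (+ 0) 0 k) n ≡ altRS k n
applyPoly-prodFrom≡altRS zero n = begin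
  + 1 * f n + + 0   ≡⟨ ℤ.+-identityʳ (+ 1 * f n) ⟩
  + 1 * f n         ≡⟨ ℤ.*-identityˡ (f n) ⟩
  f n               ≡⟨ altRS-zero n ⟨
  altRS 0 n         ∎
applyPoly-prodFrom≡altRS (suc k) n = begin
  applyPoly f (prodFrom (+ 0) 0 (suc k)) n
    ≡⟨ applyPoly-prodFrom-suc f (+ 0) 0 k n ⟩
  minusShift (+ k) (applyPoly f (prodFrom (+ 0) 0 k)) n
    ≡⟨ minusShift-cong (+ k) (applyPoly-prodFrom≡altRS k) n ⟩
  minusShift (+ k) (altRS k) n
    ≡⟨ altRS-suc k n ⟨
  altRS (suc k) n
    ∎

length-scale : ∀ c p → length (scale c p) ≡ length p
length-scale c []      = refl
length-scale c (x ∷ p) = cong suc (length-scale c p)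

length-addP : ∀ p q → length (addP p q) ≡ length p ⊔ length q
length-addP []      q       = refl
length-addP (x ∷ p) []      = refl
length-addP (x ∷ p) (y ∷ q) = cong suc (length-addP p q)

length-mulLin : ∀ c p → length (mulLin c p) ≡ suc (length p)
length-mulLin c p = begin
  length (addP (scale c p) (scale (- + 1) (shiftY p)))
    ≡⟨ length-addP (scale c p) _ ⟩
  length (scale c p) ⊔ length (scale (- + 1) (shiftY p))
    ≡⟨ cong₂ _⊔_ (length-scale c p) (length-scale _ (shiftY p)) ⟩
  length p ⊔ suc (length p)
    ≡⟨ ℕ.m≤n⇒m⊔n≡n (ℕ.n≤1+n (length p)) ⟩
  suc (length p)
    ∎

length-prodFrom : ∀ x m k → length (prodFrom x m k) ≡ suc k
length-prodFrom x m zero    = refl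
length-prodFrom x m (suc k) =
  trans (length-mulLin (x + + m) (prodFrom x (suc m) k)) (cong suc (length-prodFrom x (suc m) k))

applyPoly≡sumFrom : ∀ u p n →
  applyPoly u p n ≡ sumFrom 0 (length p) (λ r → coeff p r * u (n ℕ.+ r))
applyPoly≡sumFrom u []      n = refl
applyPoly≡sumFrom u (c ∷ p) n = cong₂ _+_
  (cong (λ i → c * u i) (sym (ℕ.+-identityʳ n)))
  (begin
    applyPoly u p (suc n)
      ≡⟨ applyPoly≡sumFrom u p (suc n) ⟩
    sumFrom 0 (length p) (λ r → coeff p r * u (suc n ℕ.+ r))
      ≡⟨ sumFrom-cong 0 (length p) (λ r → cong (λ i → coeff p r * u i) (ℕ.+-suc n r)) ⟨
    sumFrom 0 (length p) (λ r → coeff (c ∷ p) (suc r) * u (n ℕ.+ suc r))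
      ≡⟨ sumFrom-suc 0 (length p) _ ⟨
    sumFrom 1 (length p) (λ r → coeff (c ∷ p) r * u (n ℕ.+ r))
      ∎)

coeff-mulLin-zero : ∀ c p → coeff (mulLin c p) 0 ≡ c * coeff p 0
coeff-mulLin-zero c []      = sym (ℤ.*-zeroʳ c)
coeff-mulLin-zero c (x ∷ p) = ℤ.+-identityʳ (c * x)

a-zero : ∀ k → a 0 (suc k) (+ 0) ≡ + 0
a-zero k = coeff-mulLin-zero (+ 0) (prodFrom (+ 0) 1 k)

corollary3p7 : (k : ℕ) → .{{_ : NonZero k}} → (n : ℕ) →
    (+ k) ∣ (f n - sumFrom 1 k (λ r → a r k (+ 0) * f (n Data.Nat.+ r)))
corollary3p7 (suc k) n =
  ∣⇒∣ᵤ (subst (λ s → + suc k Signed.∣ f n - s) (sym tail≡altRS) (c∣f-altRS (suc k) n))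
  where
  term : ℕ → ℤ
  term r = a r (suc k) (+ 0) * f (n ℕ.+ r)

  term-zero : term 0 ≡ + 0
  term-zero = trans (cong (_* f (n ℕ.+ 0)) (a-zero k)) (ℤ.*-zeroˡ (f (n ℕ.+ 0)))

  tail≡altRS : sumFrom 1 (suc k) term ≡ altRS (suc k) n
  tail≡altRS = begin
    sumFrom 1 (suc k) term
      ≡⟨ ℤ.+-identityˡ _ ⟨
    + 0 + sumFrom 1 (suc k) term
      ≡⟨ cong (_+ sumFrom 1 (suc k) term) term-zero ⟨
    sumFrom 0 (suc (suc k)) term
      ≡⟨ cong (λ m → sumFrom 0 m term) (length-prodFrom (+ 0) 0 (suc k)) ⟨
    sumFrom 0 (length (prodFrom (+ 0) 0 (suc k))) term
      ≡⟨ applyPoly≡sumFrom f (prodFrom (+ 0) 0 (suc k)) n ⟨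
    applyPoly f (prodFrom (+ 0) 0 (suc k)) n
      ≡⟨ applyPoly-prodFrom≡altRS (suc k) n ⟩
    altRS (suc k) n
      ∎
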